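{- Let $n\ge 11$ and $1\le d\le n-1$ be integers and let $\lambda=(\lambda_1,\dots,\lambda_t)\in\mathbb U^*_{T_{n,d}}$, where $T_{n,d}=\frac{n(n+1)}{2}-d$. If $\lambda_t=2n-3$, then $d=2$, and there is exactly one such partition.
   Context: A partition of $N$ into distinct parts is a sequence of positive integers $\lambda_1<\dots<\lambda_t$ summing to $N$ with $t\ge 2$. Its missing parts are the elements of $\{1,\dots,\lambda_t\}\setminus\{\lambda_1,\dots,\lambda_t\}$. $\lambda$ is refinable if two distinct missing parts sum to a part of $\lambda$, unrefinable otherwise; $\mathbb U_N$ is the set of unrefinable partitions of $N$. $\mathbb U^*_N$ is the set of $\lambda\in\mathbb U_N$ whose largest part is the maximum of the largest parts over all of $\mathbb U_N$. Standing assumption: $n\ge 11$. -}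

module Defs where

open import Data.Nat using (ℕ; zero; suc; _+_; _*_; _∸_; _≤_; _<_; _⊔_)
open import Data.Nat.Divisibility using ()
open import Data.List using (List; length; foldr)
open import Data.Nat.ListAction using (sum)
open import Data.List.Membership.Propositional using (_∈_; _∉_)
open import Data.List.Relation.Unary.All using (All)
open import Data.List.Relation.Unary.Linked using (Linked)
open import Data.Product using (_×_; ∃-syntax)
open import Relation.Binary.PropositionalEquality using (_≡_; _≢_)
open import Relation.Nullary using (¬_)

record IsDistinctPartition (N : ℕ) (λs : List ℕ) : Set where
  field
    increasing : Linked _<_ λs
    positive   : All (λ x → 1 ≤ x) λs
    atLeastTwo : 2 ≤ length λs
    sumIs      : sum λs ≡ N

-- Largest part λₜ (the maximum of the list; equals the last entry
-- of a strictly increasing list).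
largest : List ℕ → ℕ
largest = foldr _⊔_ 0

Missing : List ℕ → ℕ → Set
Missing λs a = (1 ≤ a) × (a ≤ largest λs) × (a ∉ λs)

Refinable : List ℕ → Set
Refinable λs = ∃[ a ] ∃[ b ] (a ≢ b × Missing λs a × Missing λs b × (a + b) ∈ λs)

Unrefinable : ℕ → List ℕ → Set
Unrefinable N λs = IsDistinctPartition N λs × ¬ Refinable λs

UnrefinableMax : ℕ → List ℕ → Set
UnrefinableMax N λs =
  Unrefinable N λs × (∀ μs → Unrefinable N μs → largest μs ≤ largest λs)

triangle : ℕ → ℕ
triangle zero = zero
triangle (suc n) = suc n + triangle n

T : ℕ → ℕ → ℕ
T n d = triangle n ∸ d

{-# OPTIONS --safe #-}
-- Write n = k + 2, so that the largest part is m = 2k + 1. For every a ≤ k one of a and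
-- m − a must be a part, since otherwise these two missing parts would refine m. Weighting
-- each y ≤ m by y·[y ∈ λ] and summing over the pairs {a, m − a} gives
-- T_{n,d} ≥ (1 + ⋯ + k) + m = T_{n,2}, hence d ≤ 2. The staircase (1, …, k, 2k + 2) is an
-- unrefinable partition of T_{n,1} with a larger largest part, so d ≠ 1. For d = 2 the
-- bound is attained, which forces each pair to contribute exactly a: λ = (1, …, k, 2k + 1).
module Submission where

open import Defs
open import Data.Nat using (ℕ; zero; suc; _+_; _*_; _∸_; _≤_; _<_; z≤n; s≤s; z<s; s<s)
open import Data.Nat.Properties
open import Algebra.Properties.CommutativeSemigroup +-commutativeSemigroup using (interchange)
open import Data.Nat.Solver using (module +-*-Solver)
open import Data.Nat.ListAction using (sum)
open import Data.Nat.ListAction.Properties using (sum-++)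
open import Data.List using (List; []; _∷_; _++_; [_]; length; applyUpTo)
open import Data.List.Properties using (length-++; length-applyUpTo; foldr-preservesᵇ)
open import Data.List.Membership.Propositional using (_∈_; _∉_)
open import Data.List.Membership.Propositional.Properties
  using (∈-++⁻; ∈-++⁺ˡ; ∈-++⁺ʳ; ∈-applyUpTo⁺; ∈-applyUpTo⁻; foldr-selective)
open import Data.List.Membership.DecPropositional _≟_ using (_∈?_)
open import Data.List.Relation.Unary.Any using (here; there)
open import Data.List.Relation.Unary.All as All using (All; []; _∷_)
open import Data.List.Relation.Unary.All.Properties using (applyUpTo⁺₁)
open import Data.List.Relation.Unary.AllPairs as AllPairs using (AllPairs; []; _∷_)
import Data.List.Relation.Unary.AllPairs.Properties as AllPairsₚ
open import Data.List.Relation.Unary.Linked using (Linked)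
open import Data.List.Relation.Unary.Linked.Properties using (Linked⇒AllPairs; AllPairs⇒Linked)
open import Data.List.Relation.Unary.Unique.Propositional using (Unique)
open import Data.List.Relation.Unary.Unique.Propositional.Properties using (Unique[x∷xs]⇒x∉xs)
open import Data.Product using (_×_; _,_; proj₁; proj₂)
open import Data.Sum as Sum using (_⊎_; inj₁; inj₂)
open import Function using (_∘_)
open import Relation.Nullary using (¬_; Dec; yes; no; contradiction)
open import Relation.Binary using (tri<; tri≈; tri>)
open import Relation.Binary.PropositionalEquality
  using (_≡_; _≢_; refl; sym; trans; cong; cong₂; subst; subst₂; module ≡-Reasoning)

∑ : ℕ → (ℕ → ℕ) → ℕ
∑ n f = sum (applyUpTo f n)

syntax ∑ n (λ y → e) = ∑[ y < n ] e

∑-cong : ∀ n {f h : ℕ → ℕ} → (∀ {y} → y < n → f y ≡ h y) → ∑ n f ≡ ∑ n h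
∑-cong zero    _   = refl
∑-cong (suc n) f≡h = cong₂ _+_ (f≡h z<s) (∑-cong n (f≡h ∘ s<s))

∑-distrib-+ : ∀ n (f h : ℕ → ℕ) → ∑[ y < n ] (f y + h y) ≡ ∑ n f + ∑ n h
∑-distrib-+ zero    f h = refl
∑-distrib-+ (suc n) f h = trans (cong (f 0 + h 0 +_) (∑-distrib-+ n (f ∘ suc) (h ∘ suc)))
                                (interchange (f 0) (h 0) _ _)

∑-init-last : ∀ n (f : ℕ → ℕ) → ∑ (suc n) f ≡ ∑ n f + f n
∑-init-last zero    f = +-identityʳ (f 0)
∑-init-last (suc n) f = trans (cong (f 0 +_) (∑-init-last n (f ∘ suc))) (sym (+-assoc (f 0) _ _))

∑-vanishes : ∀ n {f : ℕ → ℕ} → (∀ y → f y ≡ 0) → ∑ n f ≡ 0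
∑-vanishes zero    _    = refl
∑-vanishes (suc n) f≡0 = cong₂ _+_ (f≡0 0) (∑-vanishes n (f≡0 ∘ suc))

∑-single : ∀ n {f : ℕ → ℕ} {x} → x < n → (∀ {y} → y ≢ x → f y ≡ 0) → ∑ n f ≡ f x
∑-single (suc n) {f} {zero} _ off =
  trans (cong (f 0 +_) (∑-vanishes n (λ y → off λ ()))) (+-identityʳ (f 0))
∑-single (suc n) {f} {suc x} (s<s x<n) off =
  trans (cong (_+ ∑ n (f ∘ suc)) (off λ ()))
        (∑-single n x<n (λ y≢x → off (y≢x ∘ suc-injective)))

∑-mono-≤ : ∀ n {f h : ℕ → ℕ} → (∀ {y} → y < n → f y ≤ h y) → ∑ n f ≤ ∑ n h
∑-mono-≤ zero    _   = z≤n
∑-mono-≤ (suc n) f≤h = +-mono-≤ (f≤h z<s) (∑-mono-≤ n (f≤h ∘ s<s))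

+-mono-≤-≡⇒≡ : ∀ {a b c d} → a ≤ b → c ≤ d → b + d ≡ a + c → b ≡ a × d ≡ c
+-mono-≤-≡⇒≡ {a} {b} {c} {d} a≤b c≤d eq =
  b≡a , +-cancelˡ-≡ a d c (trans (cong (_+ d) (sym b≡a)) eq)
  where
  b≡a : b ≡ a
  b≡a = ≤-antisym (+-cancelʳ-≤ d b a (≤-trans (≤-reflexive eq) (+-monoʳ-≤ a c≤d))) a≤b

∑-mono-≤-≡⇒≡ : ∀ n {f h : ℕ → ℕ} → (∀ {y} → y < n → f y ≤ h y) →
               ∑ n h ≡ ∑ n f → ∀ {y} → y < n → h y ≡ f y
∑-mono-≤-≡⇒≡ (suc n) f≤h eq z<s = proj₁ (+-mono-≤-≡⇒≡ (f≤h z<s) (∑-mono-≤ n (f≤h ∘ s<s)) eq)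
∑-mono-≤-≡⇒≡ (suc n) {f} {h} f≤h eq {suc y} (s<s y<n) =
  ∑-mono-≤-≡⇒≡ n {f ∘ suc} {h ∘ suc} (f≤h ∘ s<s) tails≡ y<n
  where
  tails≡ : ∑ n (h ∘ suc) ≡ ∑ n (f ∘ suc)
  tails≡ = proj₂ (+-mono-≤-≡⇒≡ (f≤h z<s) (∑-mono-≤ n (f≤h ∘ s<s)) eq)

∑-suc≡triangle : ∀ k → ∑[ y < k ] suc y ≡ triangle k
∑-suc≡triangle zero    = refl
∑-suc≡triangle (suc k) = begin
  ∑[ y < suc k ] suc y    ≡⟨ ∑-init-last k suc ⟩
  ∑[ y < k ] suc y + suc k ≡⟨ cong (_+ suc k) (∑-suc≡triangle k) ⟩
  triangle k + suc k      ≡⟨ +-comm (triangle k) (suc k) ⟩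
  triangle (suc k)        ∎
  where open ≡-Reasoning

∑-fold : ∀ k (h : ℕ → ℕ) →
         ∑[ y < k + k ] h (suc y) ≡ ∑[ a < k ] (h (suc a) + h (suc (k + k) ∸ suc a))
∑-fold zero    h = refl
∑-fold (suc k) h rewrite +-suc k k = begin
  h 1 + ∑[ y < suc (k + k) ] h (suc (suc y))
    ≡⟨ cong (h 1 +_) (∑-init-last (k + k) (h ∘ suc ∘ suc)) ⟩
  h 1 + (∑[ y < k + k ] h (suc (suc y)) + h (suc (suc (k + k))))
    ≡⟨ cong (λ s → h 1 + (s + h (suc (suc (k + k)))))
            (trans (∑-fold k (h ∘ suc)) (∑-cong k shift)) ⟩
  h 1 + (S + h (suc (suc (k + k))))
    ≡⟨ cong (h 1 +_) (+-comm S _) ⟩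
  h 1 + (h (suc (suc (k + k))) + S)
    ≡⟨ +-assoc (h 1) _ S ⟨
  h 1 + h (suc (suc (k + k))) + S ∎
  where
  open ≡-Reasoning
  S : ℕ
  S = ∑[ a < k ] (h (suc (suc a)) + h (suc (k + k) ∸ a))
  shift : ∀ {a} → a < k →
          h (suc (suc a)) + h (suc (suc (k + k) ∸ suc a)) ≡ h (suc (suc a)) + h (suc (k + k) ∸ a)
  shift {a} a<k =
    cong (λ z → h (suc (suc a)) + h z) (sym (+-∸-assoc 1 (≤-trans (<⇒≤ a<k) (m≤m+n k k))))

weight : List ℕ → ℕ → ℕ
weight l y with y ∈? l
... | yes _ = y
... | no  _ = 0

weight-∈ : ∀ {l y} → y ∈ l → weight l y ≡ y
weight-∈ {l} {y} y∈l with y ∈? l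
... | yes _   = refl
... | no  y∉l = contradiction y∈l y∉l

weight-∉ : ∀ {l y} → y ∉ l → weight l y ≡ 0
weight-∉ {l} {y} y∉l with y ∈? l
... | yes y∈l = contradiction y∈l y∉l
... | no  _   = refl

weight-∷-≢ : ∀ {x l y} → y ≢ x → weight (x ∷ l) y ≡ weight l y
weight-∷-≢ {x} {l} {y} y≢x = by-cases (y ∈? l)
  where
  by-cases : Dec (y ∈ l) → weight (x ∷ l) y ≡ weight l y
  by-cases (yes y∈l) = trans (weight-∈ {x ∷ l} (there y∈l)) (sym (weight-∈ y∈l))
  by-cases (no  y∉l) =
    trans (weight-∉ {x ∷ l} λ { (here y≡x) → y≢x y≡x ; (there y∈l) → y∉l y∈l }) (sym (weight-∉ y∉l))

weight-∷ : ∀ {x l} y → x ∉ l → weight (x ∷ l) y ≡ weight [ x ] y + weight l y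
weight-∷ {x} {l} y x∉l = by-cases (y ≟ x)
  where
  by-cases : Dec (y ≡ x) → weight (x ∷ l) y ≡ weight [ x ] y + weight l y
  by-cases (yes refl) = begin
    weight (x ∷ l) x           ≡⟨ weight-∈ {x ∷ l} (here refl) ⟩
    x                          ≡⟨ +-identityʳ x ⟨
    x + 0                      ≡⟨ cong₂ _+_ (weight-∈ {[ x ]} (here refl)) (weight-∉ x∉l) ⟨
    weight [ x ] x + weight l x ∎
    where open ≡-Reasoning
  by-cases (no  y≢x)  =
    trans (weight-∷-≢ y≢x) (cong (_+ weight l y) (sym (weight-∷-≢ {l = []} y≢x)))

sum≡∑weight : ∀ {N l} → Unique l → All (_< N) l → sum l ≡ ∑[ y < N ] weight l y
sum≡∑weight {N} {[]}    _ _ = sym (∑-vanishes N λ _ → refl)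
sum≡∑weight {N} {x ∷ l} l-unique@(_ ∷ l′-unique) (x<N ∷ l<N) = begin
  x + sum l                                          ≡⟨ cong₂ _+_ x≡∑ (sum≡∑weight l′-unique l<N) ⟩
  ∑[ y < N ] weight [ x ] y + ∑[ y < N ] weight l y ≡⟨ ∑-distrib-+ N (weight [ x ]) (weight l) ⟨
  ∑[ y < N ] (weight [ x ] y + weight l y)          ≡⟨ ∑-cong N (λ {y} _ → weight-∷ y x∉l) ⟨
  ∑[ y < N ] weight (x ∷ l) y                        ∎
  where
  open ≡-Reasoning
  x∉l : x ∉ l
  x∉l = Unique[x∷xs]⇒x∉xs l-unique
  x≡∑ : x ≡ ∑[ y < N ] weight [ x ] y
  x≡∑ = sym (trans (∑-single N x<N (λ y≢x → weight-∷-≢ {l = []} y≢x)) (weight-∈ {[ x ]} (here refl)))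

largest-∈ : ∀ {l} → 0 < largest l → largest l ∈ l
largest-∈ {l} 0<largest with foldr-selective ⊔-sel 0 l
... | inj₁ largest≡0 = contradiction (subst (0 <_) largest≡0 0<largest) (<-irrefl refl)
... | inj₂ largest∈l = largest∈l

∈⇒≤largest : ∀ {x l} → x ∈ l → x ≤ largest l
∈⇒≤largest {l = y ∷ ys} (here refl) = m≤m⊔n y (largest ys)
∈⇒≤largest {l = y ∷ ys} (there x∈ys) = ≤-trans (∈⇒≤largest x∈ys) (m≤n⊔m y (largest ys))

largest≡ : ∀ {e l} → e ∈ l → All (_≤ e) l → largest l ≡ e
largest≡ e∈l l≤e = ≤-antisym (foldr-preservesᵇ ⊔-lub z≤n l≤e) (∈⇒≤largest e∈l)

strictlySorted-∈-ext : ∀ {xs ys} → AllPairs _<_ xs → AllPairs _<_ ys →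
                       (∀ {z} → z ∈ xs → z ∈ ys) → (∀ {z} → z ∈ ys → z ∈ xs) → xs ≡ ys
strictlySorted-∈-ext {[]}     {[]}     _ _ _ _ = refl
strictlySorted-∈-ext {[]}     {y ∷ ys} _ _ _ ys⊆ with () ← ys⊆ (here refl)
strictlySorted-∈-ext {x ∷ xs} {[]}     _ _ xs⊆ _ with () ← xs⊆ (here refl)
strictlySorted-∈-ext {x ∷ xs} {y ∷ ys} (x<xs ∷ xs<) (y<ys ∷ ys<) xs⊆ ys⊆
  with xs⊆ (here refl) | ys⊆ (here refl)
... | here refl  | _          =
  cong (x ∷_) (strictlySorted-∈-ext xs< ys< (drop x<xs xs⊆) (drop y<ys ys⊆))
  where
  drop : ∀ {u us vs} → All (u <_) us → (∀ {z} → z ∈ u ∷ us → z ∈ u ∷ vs) →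
         ∀ {z} → z ∈ us → z ∈ vs
  drop u<us ⊆ z∈us with ⊆ (there z∈us)
  ... | here refl = contradiction (All.lookup u<us z∈us) (<-irrefl refl)
  ... | there z∈vs = z∈vs
... | there x∈ys | here refl  = contradiction (All.lookup y<ys x∈ys) (<-irrefl refl)
... | there x∈ys | there y∈xs = contradiction (All.lookup x<xs y∈xs) (<-asym (All.lookup y<ys x∈ys))

staircase : ℕ → ℕ → List ℕ
staircase k e = applyUpTo suc k ++ [ e ]

∈-staircase⁻ : ∀ {k e x} → x ∈ staircase k e → (1 ≤ x × x ≤ k) ⊎ x ≡ e
∈-staircase⁻ {k} x∈ with ∈-++⁻ (applyUpTo suc k) x∈
... | inj₁ x∈1…k with i , i<k , refl ← ∈-applyUpTo⁻ suc x∈1…k = inj₁ (s≤s z≤n , i<k)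
... | inj₂ (here x≡e) = inj₂ x≡e

∈-staircase⁺ : ∀ {k e x} → (1 ≤ x × x ≤ k) ⊎ x ≡ e → x ∈ staircase k e
∈-staircase⁺ {x = suc i} (inj₁ (_ , i<k)) = ∈-++⁺ˡ (∈-applyUpTo⁺ suc i<k)
∈-staircase⁺ {k}         (inj₂ refl)      = ∈-++⁺ʳ (applyUpTo suc k) (here refl)

staircase-increasing : ∀ {k e} → k < e → AllPairs _<_ (staircase k e)
staircase-increasing {k} k<e =
  AllPairsₚ.++⁺ (AllPairsₚ.applyUpTo⁺₁ suc k (λ i<j _ → s<s i<j)) ([] ∷ [])
                (applyUpTo⁺₁ suc k (λ i<k → ≤-<-trans i<k k<e ∷ []))

staircase-positive : ∀ {k e} → 1 ≤ e → All (1 ≤_) (staircase k e)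
staircase-positive 1≤e = All.tabulate (λ x∈ → Sum.[ proj₁ , (λ { refl → 1≤e }) ] (∈-staircase⁻ x∈))

staircase-≤ : ∀ {k e} → k < e → All (_≤ e) (staircase k e)
staircase-≤ k<e =
  All.tabulate (λ x∈ → Sum.[ (λ (_ , x≤k) → ≤-trans x≤k (<⇒≤ k<e)) , ≤-reflexive ] (∈-staircase⁻ x∈))

staircase-largest : ∀ {k e} → k < e → largest (staircase k e) ≡ e
staircase-largest {k} k<e = largest≡ (∈-++⁺ʳ (applyUpTo suc k) (here refl)) (staircase-≤ k<e)

staircase-length : ∀ k e → length (staircase k e) ≡ k + 1
staircase-length k e =
  trans (length-++ (applyUpTo suc k)) (cong (_+ 1) (length-applyUpTo suc k))

staircase-sum : ∀ k e → sum (staircase k e) ≡ triangle k + e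
staircase-sum k e =
  trans (sum-++ (applyUpTo suc k) [ e ]) (cong₂ _+_ (∑-suc≡triangle k) (+-identityʳ e))

-- Missing parts exceed k, so two distinct ones sum to more than 2k + 2.
staircase-unrefinable : ∀ {k e} → e ≤ suc k + suc k → ¬ Refinable (staircase k e)
staircase-unrefinable {k} {e} e≤2k+2
                      (a , b , a≢b , (1≤a , _ , a∉) , (1≤b , _ , b∉) , a+b∈) =
  Sum.[ (λ (_ , a+b≤k) → ≤⇒≯ a+b≤k (≤-trans (missing⇒k< 1≤a a∉) (m≤m+n a b)))
      , (λ a+b≡e → <⇒≱ 2k+2<a+b (≤-trans (≤-reflexive a+b≡e) e≤2k+2)) ] (∈-staircase⁻ a+b∈)
  where
  missing⇒k< : ∀ {x} → 1 ≤ x → x ∉ staircase k e → k < x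
  missing⇒k< 1≤x x∉ = ≰⇒> (λ x≤k → x∉ (∈-staircase⁺ (inj₁ (1≤x , x≤k))))
  ordered : ∀ {x y} → k < x → x < y → suc k + suc k < x + y
  ordered {x} {y} k<x x<y =
    subst (_≤ x + y) (+-suc (suc k) (suc k)) (+-mono-≤ k<x (≤-trans (s≤s k<x) x<y))
  2k+2<a+b : suc k + suc k < a + b
  2k+2<a+b with <-cmp a b
  ... | tri< a<b _ _ = ordered (missing⇒k< 1≤a a∉) a<b
  ... | tri≈ _ a≡b _ = contradiction a≡b a≢b
  ... | tri> _ _ b<a = subst (suc k + suc k <_) (+-comm b a) (ordered (missing⇒k< 1≤b b∉) b<a)

unrefinable⇒complement∈ : ∀ {l x a} → ¬ Refinable l → x ∈ l → 1 ≤ a → a < x ∸ a →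
                          a ∈ l ⊎ x ∸ a ∈ l
unrefinable⇒complement∈ {l} {x} {a} unrefinable x∈l 1≤a a<x∸a with a ∈? l | x ∸ a ∈? l
... | yes a∈l | _          = inj₁ a∈l
... | no  _   | yes x∸a∈l = inj₂ x∸a∈l
... | no  a∉l | no  x∸a∉l = contradiction
  (a , x ∸ a , <⇒≢ a<x∸a , (1≤a , ≤-trans a≤x x≤largest , a∉l)
    , (≤-trans 1≤a (<⇒≤ a<x∸a) , ≤-trans (m∸n≤m x a) x≤largest , x∸a∉l)
    , subst (_∈ l) (sym (m+[n∸m]≡n a≤x)) x∈l)
  unrefinable
  where
  x≤largest : x ≤ largest l
  x≤largest = ∈⇒≤largest x∈l
  a≤x : a ≤ x
  a≤x = ≤-trans (<⇒≤ a<x∸a) (m∸n≤m x a)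

module LargestPart2k+1 (k : ℕ) {l : List ℕ}
                       (increasing : Linked _<_ l) (positive : All (1 ≤_) l)
                       (unrefinable : ¬ Refinable l) (largest≡m : largest l ≡ suc (k + k)) where

  m : ℕ
  m = suc (k + k)

  m∈l : m ∈ l
  m∈l = subst (_∈ l) largest≡m (largest-∈ (subst (0 <_) (sym largest≡m) z<s))

  parts≤m : ∀ {x} → x ∈ l → x ≤ m
  parts≤m x∈l = subst (_ ≤_) largest≡m (∈⇒≤largest x∈l)

  k<complement : ∀ {a} → a < k → k < m ∸ suc a
  k<complement {a} a<k = subst (k <_) (sym (+-∸-assoc k (<⇒≤ a<k))) (m<m+n k (m<n⇒0<n∸m a<k))

  suc∈l⊎complement∈l : ∀ {a} → a < k → suc a ∈ l ⊎ m ∸ suc a ∈ l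
  suc∈l⊎complement∈l a<k =
    unrefinable⇒complement∈ unrefinable m∈l (s≤s z≤n) (≤-<-trans a<k (k<complement a<k))

  pairWeight : ℕ → ℕ
  pairWeight a = weight l (suc a) + weight l (m ∸ suc a)

  suc≤pairWeight : ∀ {a} → a < k → suc a ≤ pairWeight a
  suc≤pairWeight {a} a<k with suc∈l⊎complement∈l a<k
  ... | inj₁ suc-a∈l = begin
    suc a                ≡⟨ weight-∈ suc-a∈l ⟨
    weight l (suc a)     ≤⟨ m≤m+n _ _ ⟩
    pairWeight a         ∎
    where open ≤-Reasoning
  ... | inj₂ complement∈l = begin
    suc a                  ≤⟨ <⇒≤ (≤-<-trans a<k (k<complement a<k)) ⟩
    m ∸ suc a              ≡⟨ weight-∈ complement∈l ⟨
    weight l (m ∸ suc a)   ≤⟨ m≤n+m _ _ ⟩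
    pairWeight a           ∎
    where open ≤-Reasoning

  sum≡∑pairWeight+m : sum l ≡ ∑ k pairWeight + m
  sum≡∑pairWeight+m = begin
    sum l
      ≡⟨ sum≡∑weight unique (All.tabulate (s≤s ∘ parts≤m)) ⟩
    weight l 0 + ∑[ y < m ] weight l (suc y)
      ≡⟨ cong₂ _+_ (weight-∉ 0∉l) (∑-init-last (k + k) (weight l ∘ suc)) ⟩
    ∑[ y < k + k ] weight l (suc y) + weight l m
      ≡⟨ cong₂ _+_ (∑-fold k (weight l)) (weight-∈ m∈l) ⟩
    ∑ k pairWeight + m ∎
    where
    open ≡-Reasoning
    unique : Unique l
    unique = AllPairs.map <⇒≢ (Linked⇒AllPairs <-trans increasing)
    0∉l : 0 ∉ l
    0∉l 0∈l = n≮0 (All.lookup positive 0∈l)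

  triangle+m≤sum : triangle k + m ≤ sum l
  triangle+m≤sum = begin
    triangle k + m         ≡⟨ cong (_+ m) (∑-suc≡triangle k) ⟨
    ∑[ a < k ] suc a + m   ≤⟨ +-monoˡ-≤ m (∑-mono-≤ k suc≤pairWeight) ⟩
    ∑ k pairWeight + m     ≡⟨ sum≡∑pairWeight+m ⟨
    sum l                  ∎
    where open ≤-Reasoning

  module _ (sum≡triangle+m : sum l ≡ triangle k + m) where

    pairWeight≡suc : ∀ {a} → a < k → pairWeight a ≡ suc a
    pairWeight≡suc = ∑-mono-≤-≡⇒≡ k suc≤pairWeight (+-cancelʳ-≡ m _ _ (begin
      ∑ k pairWeight + m     ≡⟨ sum≡∑pairWeight+m ⟨
      sum l                  ≡⟨ sum≡triangle+m ⟩
      triangle k + m         ≡⟨ cong (_+ m) (∑-suc≡triangle k) ⟨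
      ∑[ a < k ] suc a + m   ∎))
      where open ≡-Reasoning

    complement∉l : ∀ {a} → a < k → m ∸ suc a ∉ l
    complement∉l {a} a<k complement∈l = <-irrefl refl (begin-strict
      suc a                  ≤⟨ a<k ⟩
      k                      <⟨ k<complement a<k ⟩
      m ∸ suc a              ≡⟨ weight-∈ complement∈l ⟨
      weight l (m ∸ suc a)   ≤⟨ m≤n+m _ _ ⟩
      pairWeight a           ≡⟨ pairWeight≡suc a<k ⟩
      suc a                  ∎)
      where open ≤-Reasoning

    ∈l⇒∈staircase : ∀ {x} → x ∈ l → x ∈ staircase k m
    ∈l⇒∈staircase {x} x∈l with x ≟ m | x ≤? k
    ... | yes x≡m | _       = ∈-staircase⁺ (inj₂ x≡m)
    ... | no  _   | yes x≤k = ∈-staircase⁺ (inj₁ (All.lookup positive x∈l , x≤k))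
    ... | no  x≢m | no  x≰k =
      contradiction (subst (_∈ l) (sym (m∸[m∸n]≡n x≤k+k)) x∈l) (complement∉l a<k)
      where
      x≤k+k : x ≤ k + k
      x≤k+k = ≤-pred (≤∧≢⇒< (parts≤m x∈l) x≢m)
      a<k : k + k ∸ x < k
      a<k = subst (k + k ∸ x <_) (m+n∸n≡m k k) (∸-monoʳ-< (≰⇒> x≰k) x≤k+k)

    ∈staircase⇒∈l : ∀ {x} → x ∈ staircase k m → x ∈ l
    ∈staircase⇒∈l x∈ with ∈-staircase⁻ x∈
    ... | inj₂ refl                = m∈l
    ... | inj₁ (s≤s z≤n , a<k) with suc∈l⊎complement∈l a<k
    ...   | inj₁ x∈l              = x∈l
    ...   | inj₂ complement∈l     = contradiction complement∈l (complement∉l a<k)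

    l≡staircase : l ≡ staircase k m
    l≡staircase = strictlySorted-∈-ext (Linked⇒AllPairs <-trans increasing)
                                       (staircase-increasing (s≤s (m≤m+n k k)))
                                       ∈l⇒∈staircase ∈staircase⇒∈l

T[2+k]≡ : ∀ k d → T (suc (suc k)) d ≡ 2 + (triangle k + suc (k + k)) ∸ d
T[2+k]≡ k d = cong (λ t → suc (suc t) ∸ d)
  (solve 2 (λ k t → k :+ (con 1 :+ (k :+ t)) := t :+ (con 1 :+ (k :+ k))) refl k (triangle k))
  where open +-*-Solver

2[2+k]∸3≡1+2k : ∀ k → 2 * suc (suc k) ∸ 3 ≡ suc (k + k)
2[2+k]∸3≡1+2k k =
  cong (_∸ 3) (solve 1 (λ k → con 2 :* (con 2 :+ k) := con 3 :+ (con 1 :+ (k :+ k))) refl k)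
  where open +-*-Solver

≤2+n∸d⇒d≤2 : ∀ {n d} → 0 < n → n ≤ 2 + n ∸ d → d ≤ 2
≤2+n∸d⇒d≤2 {d = 0} _ _ = z≤n
≤2+n∸d⇒d≤2 {d = 1} _ _ = s≤s z≤n
≤2+n∸d⇒d≤2 {d = 2} _ _ = ≤-refl
≤2+n∸d⇒d≤2 {suc n} {suc (suc (suc d))} _ n<n∸d =
  contradiction (≤-trans n<n∸d (m∸n≤m n d)) 1+n≰n

largest≡2k+1⇒d≤2 : ∀ {k d l} → Unrefinable (T (suc (suc k)) d) l → largest l ≡ suc (k + k) →
                   d ≤ 2
largest≡2k+1⇒d≤2 {k} {d} (p , unrefinable) largest≡m =
  ≤2+n∸d⇒d≤2 (≤-trans (s≤s z≤n) (m≤n+m _ (triangle k)))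
    (subst (triangle k + suc (k + k) ≤_) (trans sumIs (T[2+k]≡ k d))
      (LargestPart2k+1.triangle+m≤sum k increasing positive unrefinable largest≡m))
  where open IsDistinctPartition p

largest≡2k+1⇒≡staircase : ∀ {k l} → Unrefinable (T (suc (suc k)) 2) l → largest l ≡ suc (k + k) →
                          l ≡ staircase k (suc (k + k))
largest≡2k+1⇒≡staircase {k} (p , unrefinable) largest≡m =
  LargestPart2k+1.l≡staircase k increasing positive unrefinable largest≡m
                              (trans sumIs (T[2+k]≡ k 2))
  where open IsDistinctPartition p

staircase-∈𝕌[T1] : ∀ k → 1 ≤ k →
                  Unrefinable (T (suc (suc k)) 1) (staircase k (suc (suc (k + k))))
staircase-∈𝕌[T1] k 1≤k = record
  { increasing = AllPairs⇒Linked (staircase-increasing (s≤s (≤-trans (m≤m+n k k) (n≤1+n _))))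
  ; positive   = staircase-positive (s≤s z≤n)
  ; atLeastTwo = subst (2 ≤_) (sym (staircase-length k _)) (+-monoˡ-≤ 1 1≤k)
  ; sumIs      = trans (staircase-sum k _) (trans (+-suc (triangle k) _) (sym (T[2+k]≡ k 1)))
  } , staircase-unrefinable (≤-reflexive (cong suc (sym (+-suc k k))))

proposition2p8 : (n d : ℕ) → 11 ≤ n → 1 ≤ d → d ≤ n ∸ 1 →
    (λs : List ℕ) → UnrefinableMax (T n d) λs → largest λs ≡ 2 * n ∸ 3 →
    (d ≡ 2) ×
    (∀ (μs : List ℕ) → UnrefinableMax (T n d) μs → largest μs ≡ 2 * n ∸ 3 → μs ≡ λs)
proposition2p8 (suc zero) _ (s≤s ()) _ _ _ _ _
proposition2p8 (suc (suc k)) d 11≤n 1≤d _ λs (λs∈𝕌 , λs-maximal) λs-largest =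
  d≡2 , λ μs (μs∈𝕌 , _) μs-largest →
    trans (≡staircase μs μs∈𝕌 μs-largest) (sym (≡staircase λs λs∈𝕌 λs-largest))
  where
  largest≡2k+1 : ∀ l → largest l ≡ 2 * suc (suc k) ∸ 3 → largest l ≡ suc (k + k)
  largest≡2k+1 _ eq = trans eq (2[2+k]∸3≡1+2k k)

  d≢1 : d ≢ 1
  d≢1 refl = 1+n≰n (subst₂ _≤_ (staircase-largest (s≤s (≤-trans (m≤m+n k k) (n≤1+n _))))
                                (largest≡2k+1 λs λs-largest)
                                (λs-maximal _ (staircase-∈𝕌[T1] k 1≤k)))
    where
    1≤k : 1 ≤ k
    1≤k = ≤-trans (s≤s z≤n) (≤-pred (≤-pred 11≤n))

  d≡2 : d ≡ 2
  d≡2 = ≤-antisym (largest≡2k+1⇒d≤2 λs∈𝕌 (largest≡2k+1 λs λs-largest)) (≤∧≢⇒< 1≤d (d≢1 ∘ sym))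

  ≡staircase : ∀ l → Unrefinable (T (suc (suc k)) d) l → largest l ≡ 2 * suc (suc k) ∸ 3 →
               l ≡ staircase k (suc (k + k))
  ≡staircase l l∈𝕌 l-largest =
    largest≡2k+1⇒≡staircase (subst (λ d → Unrefinable (T (suc (suc k)) d) l) d≡2 l∈𝕌)
                            (largest≡2k+1 l l-largest)
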